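{- The largest prime $p$ that divides some Carmichael number $N \le 10^{18}$ is $p = 704988733$; it divides $N = 994018226608901845 = 5 \cdot 13 \cdot 1733 \cdot 12517 \cdot 704988733$.
   Context: A Carmichael number is a composite positive integer $N$ such that $b^{N-1} \equiv 1 \pmod{N}$ for every integer $b$ with $\gcd(b,N)=1$. Equivalently, $N$ is composite, square-free, and $p-1 \mid N-1$ for every prime $p \mid N$. -}

module Defs where

open import Data.Nat using (ℕ; _∸_)
open import Data.Nat.Primality using (Composite)
open import Data.Integer using (ℤ; +_; _-_; _^_)
open import Data.Integer.Coprimality using (Coprime)
open import Data.Integer.Divisibility using (_∣_)
open import Data.Product using (_×_)

IsCarmichael : (N : ℕ) → Set
IsCarmichael N =
  Composite N × (∀ (b : ℤ) → Coprime b (+ N) →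
    (+ N) ∣ ((b ^ (N ∸ 1)) - + 1))

-- A Carmichael number N is squarefree and p − 1 ∣ N − 1 for every prime p ∣ N (Korselt). The
-- divisibility comes from Fermat's little theorem together with the vanishing modulo p of the
-- power sums 0ʲ + 1ʲ + ⋯ + (p − 1)ʲ for j < p − 1: if xᵉ ≡ 1 for every unit x and p − 1 ∤ e,
-- reducing e modulo p − 1 gives an exponent 0 < r < p − 1 whose power sum is ≡ p − 1 instead.
-- Writing N = p (1 + k (p − 1)), a prime p > 704988733 would need k ≠ 0 (N is composite),
-- k ≠ 1 (N is squarefree) and k < 3 (otherwise N > 10¹⁸), so N = p (2p − 1) with
-- p ≤ 707106781. Each of these 2118048 candidates is refuted by evaluation: p has a prime
-- factor below 100, or some prime q < 100 dividing N violates Korselt's condition, or some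
-- prime b < 100 not dividing N has b^(N−1) ≢ 1 (mod N). Conversely 994018226608901845 is the
-- product of the distinct primes 5, 13, 1733, 12517 and 704988733, each q of which satisfies
-- q − 1 ∣ N − 1, so Fermat's little theorem modulo each q gives the Carmichael congruence.
module Submission where

open import Defs
open import Data.Nat using (ℕ; _≤_; _^_; _*_)
open import Data.Nat.Primality using (Prime)
open import Data.Nat.Divisibility using (_∣_)
open import Data.Product using (_×_)
open import Relation.Binary.PropositionalEquality using (_≡_)

open import Data.Bool.Base using (Bool; true; false; T; not; _∧_; _∨_)
open import Data.Bool.Properties using (T-∧; T-∨; T-≡)
open import Data.Empty using (⊥-elim)
open import Data.Fin.Base using (Fin; zero; suc; toℕ)
open import Data.Fin.Properties using (toℕ-inject₁; toℕ-fromℕ; toℕ<n)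
import Data.Integer.Base as ℤ
import Data.Integer.Properties as ℤ
open import Data.List.Base using (List; []; _∷_)
open import Data.List.Membership.Propositional using (_∈_)
open import Data.List.Relation.Unary.All as All using (All; all?; []; _∷_)
open import Data.List.Relation.Unary.AllPairs using (AllPairs; allPairs?; []; _∷_)
open import Data.List.Relation.Unary.Any using (here; there)
open import Data.Nat.Base
open import Data.Nat.Combinatorics using (_C_; nCk≡n!/k![n-k]!; k![n∸k]!∣n!; nCn≡1; nC1≡n; nCk≡nC[n∸k])
open import Data.Nat.Coprimality using (Coprime; 0-coprimeTo-m⇒m≡1; coprime⇒gcd≡1)
open import Data.Nat.Divisibility
open import Data.Nat.DivMod hiding (_mod_)
open import Data.Nat.Induction using (<-rec)
open import Data.Nat.GCD using (gcd)
open import Data.Nat.LCM using (lcm; gcd*lcm; lcm-least)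
open import Data.Nat.ListAction using (product)
open import Data.Nat.ListAction.Properties using (∈⇒∣product)
open import Data.Nat.Primality
open import Data.Nat.Primality.Factorisation using (factorise; factorisationHasAllPrimeFactors)
open import Data.Nat.Properties
open import Data.Nat.Tactic.RingSolver using (solve-∀)
open import Data.Product.Base using (∃-syntax; _,_; proj₁; proj₂)
open import Data.Sum.Base using (inj₁; inj₂; [_,_]′)
open import Function.Base using (_∘_; _$_; flip; id)
open import Function.Bundles using (Equivalence)
open import Level using (0ℓ)
open import Relation.Binary.Bundles using (Setoid)
open import Relation.Binary.PropositionalEquality
open import Relation.Nullary.Decidable using (from-yes; yes; no; ¬?; decidable-stable)
open import Relation.Nullary.Negation using (¬_; contradiction)
import Relation.Binary.Reasoning.Setoid as ≈-Reasoning
open import Algebra.Definitions.RawSemiring +-*-rawSemiring using () renaming (_×_ to _×ₛ_; _^_ to _^ₛ_)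
open import Algebra.Properties.CommutativeMonoid.Sum +-0-commutativeMonoid
  using (sum-syntax; sum⁺-syntax; sum-init-last; sum-cong-≗; ∑-distrib-+; sum-replicate; sum-replicate-zero)
open import Algebra.Properties.CommutativeSemiring.Binomial +-*-commutativeSemiring
  using () renaming (theorem to binomialTheorem)

open Equivalence using (to)

infix 4 _≡_mod_
_≡_mod_ : ℕ → ℕ → (n : ℕ) → .{{NonZero n}} → Set
a ≡ b mod n = a % n ≡ b % n

module _ {n : ℕ} .{{_ : NonZero n}} where

  ≡-mod-setoid : Setoid 0ℓ 0ℓ
  ≡-mod-setoid = record
    { _≈_           = _≡_mod n
    ; isEquivalence = record { refl = refl ; sym = sym ; trans = trans }
    }

  +-cong-mod : ∀ {a b c d} → a ≡ b mod n → c ≡ d mod n → a + c ≡ b + d mod n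
  +-cong-mod {a} {b} {c} {d} a≡b c≡d = begin
    (a + c) % n         ≡⟨ %-distribˡ-+ a c n ⟩
    (a % n + c % n) % n ≡⟨ cong₂ (λ x y → (x + y) % n) a≡b c≡d ⟩
    (b % n + d % n) % n ≡⟨ %-distribˡ-+ b d n ⟨
    (b + d) % n         ∎
    where open ≡-Reasoning

  *-cong-mod : ∀ {a b c d} → a ≡ b mod n → c ≡ d mod n → a * c ≡ b * d mod n
  *-cong-mod {a} {b} {c} {d} a≡b c≡d = begin
    (a * c) % n           ≡⟨ %-distribˡ-* a c n ⟩
    (a % n * (c % n)) % n ≡⟨ cong₂ (λ x y → (x * y) % n) a≡b c≡d ⟩
    (b % n * (d % n)) % n ≡⟨ %-distribˡ-* b d n ⟨
    (b * d) % n           ∎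
    where open ≡-Reasoning

  ^-cong-mod : ∀ {a b} e → a ≡ b mod n → a ^ e ≡ b ^ e mod n
  ^-cong-mod zero    a≡b = refl
  ^-cong-mod (suc e) a≡b = *-cong-mod a≡b (^-cong-mod e a≡b)

  ∣⇒≡0-mod : ∀ {a} → n ∣ a → a ≡ 0 mod n
  ∣⇒≡0-mod {a} n∣a = trans (n∣m⇒m%n≡0 a n n∣a) (sym (n∣m⇒m%n≡0 0 n (n ∣0)))

  ≡-mod⇒∣∸ : ∀ {a b} → a ≡ b mod n → n ∣ a ∸ b
  ≡-mod⇒∣∸ {a} {b} a≡b = divides (a / n ∸ b / n) (begin
    a ∸ b                                     ≡⟨ cong₂ _∸_ (m≡m%n+[m/n]*n a n) (m≡m%n+[m/n]*n b n) ⟩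
    (a % n + a / n * n) ∸ (b % n + b / n * n) ≡⟨ cong (λ r → (r + a / n * n) ∸ (b % n + b / n * n)) a≡b ⟩
    (b % n + a / n * n) ∸ (b % n + b / n * n) ≡⟨ [m+n]∸[m+o]≡n∸o (b % n) _ _ ⟩
    a / n * n ∸ b / n * n                     ≡⟨ *-distribʳ-∸ n (a / n) (b / n) ⟨
    (a / n ∸ b / n) * n                       ∎)
    where open ≡-Reasoning

  ∣∸⇒≡-mod : ∀ {a b} → b ≤ a → n ∣ a ∸ b → a ≡ b mod n
  ∣∸⇒≡-mod {a} {b} b≤a n∣a∸b = begin
    a % n             ≡⟨ cong (_% n) (m+[n∸m]≡n b≤a) ⟨
    (b + (a ∸ b)) % n ≡⟨ %-remove-+ʳ b n∣a∸b ⟩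
    b % n             ∎
    where open ≡-Reasoning

prime>1 : ∀ {p} → Prime p → 1 < p
prime>1 {p} p-prime = nonTrivial⇒n>1 p {{prime⇒nonTrivial p-prime}}

0<m<p⇒p∤m : ∀ {p m} → Prime p → 0 < m → m < p → p ∤ m
0<m<p⇒p∤m p-prime 0<m m<p p∣m = <⇒≱ m<p (∣⇒≤ {{>-nonZero 0<m}} p∣m)

prime∣prime⇒≡ : ∀ {p q} → Prime p → Prime q → q ∣ p → q ≡ p
prime∣prime⇒≡ p-prime q-prime q∣p with prime⇒irreducible p-prime q∣p
... | inj₁ refl = contradiction q-prime ¬prime[1]
... | inj₂ q≡p  = q≡p

prime∤⇒coprime : ∀ {p n} → Prime p → p ∤ n → Coprime p n
prime∤⇒coprime p-prime p∤n {i} (i∣p , i∣n) with prime⇒irreducible p-prime i∣p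
... | inj₁ i≡1 = i≡1
... | inj₂ refl = contradiction i∣n p∤n

primeDivisor : ∀ {n} → 1 < n → ∃[ q ] Prime q × q ∣ n
primeDivisor {n} 1<n with factorise n {{>-nonZero (<-trans z<s 1<n)}}
... | record { factors = [] ; isFactorisation = n≡1 } = contradiction n≡1 (>⇒≢ 1<n)
... | record { factors = q ∷ qs ; isFactorisation = n≡q*∏qs ; factorsPrime = q-prime ∷ _ } =
  q , q-prime , divides (product qs) (trans n≡q*∏qs (*-comm q (product qs)))

noCommonPrime⇒coprime : ∀ {m n} → (∀ {q} → Prime q → q ∣ m → q ∤ n) → Coprime m n
noCommonPrime⇒coprime noCommon {0} (0∣m , 0∣n) = ⊥-elim $
  noCommon prime[2] (subst (2 ∣_) (sym (0∣⇒≡0 0∣m)) (2 ∣0)) (subst (2 ∣_) (sym (0∣⇒≡0 0∣n)) (2 ∣0))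
noCommonPrime⇒coprime noCommon {1} _ = refl
noCommonPrime⇒coprime noCommon {suc (suc i)} (i∣m , i∣n) with primeDivisor {suc (suc i)} (s<s z<s)
... | q , q-prime , q∣i = contradiction (∣-trans q∣i i∣n) (noCommon q-prime (∣-trans q∣i i∣m))

coprime⇒*∣ : ∀ {m n c} → Coprime m n → m ∣ c → n ∣ c → m * n ∣ c
coprime⇒*∣ {m} {n} m⊥n m∣c n∣c = subst (_∣ _) lcm≡m*n (lcm-least m∣c n∣c)
  where
    lcm≡m*n : lcm m n ≡ m * n
    lcm≡m*n = begin
      lcm m n           ≡⟨ *-identityˡ (lcm m n) ⟨
      1 * lcm m n       ≡⟨ cong (_* lcm m n) (coprime⇒gcd≡1 m⊥n) ⟨
      gcd m n * lcm m n ≡⟨ gcd*lcm m n ⟩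
      m * n             ∎
      where open ≡-Reasoning

distinctPrimes-∣⇒product∣ : ∀ {qs c} → All Prime qs → AllPairs _≢_ qs → All (_∣ c) qs → product qs ∣ c
distinctPrimes-∣⇒product∣ {[]}     {c} _ _ _ = 1∣ c
distinctPrimes-∣⇒product∣ {q ∷ qs} (q-prime ∷ qs-prime) (q∉qs ∷ qs-distinct) (q∣c ∷ qs∣c) =
  coprime⇒*∣ (prime∤⇒coprime q-prime q∤∏qs) q∣c (distinctPrimes-∣⇒product∣ qs-prime qs-distinct qs∣c)
  where
    q∤∏qs : q ∤ product qs
    q∤∏qs q∣∏qs = All.lookup q∉qs (factorisationHasAllPrimeFactors q-prime q∣∏qs qs-prime) refl

prime∤m! : ∀ {p} m → Prime p → m < p → p ∤ m !
prime∤m! zero    p-prime _   p∣1 = 0<m<p⇒p∤m p-prime z<s (prime>1 p-prime) p∣1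
prime∤m! (suc m) p-prime m<p p∣m! with euclidsLemma (suc m) (m !) p-prime p∣m!
... | inj₁ p∣1+m = 0<m<p⇒p∤m p-prime z<s m<p p∣1+m
... | inj₂ p∣m!  = prime∤m! m p-prime (<-trans (n<1+n m) m<p) p∣m!

nCk*k!*[n∸k]!≡n! : ∀ {n k} → k ≤ n → (n C k) * (k ! * (n ∸ k) !) ≡ n !
nCk*k!*[n∸k]!≡n! {n} {k} k≤n = begin
  (n C k) * (k ! * (n ∸ k) !)                 ≡⟨ cong (_* (k ! * (n ∸ k) !)) (nCk≡n!/k![n-k]! k≤n) ⟩
  n ! / (k ! * (n ∸ k) !) * (k ! * (n ∸ k) !) ≡⟨ m/n*n≡m (k![n∸k]!∣n! k≤n) ⟩
  n !                                         ∎
  where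
    open ≡-Reasoning
    instance _ = k !* (n ∸ k) !≢0

prime∣pCk : ∀ {p k} → Prime p → 0 < k → k < p → p ∣ p C k
prime∣pCk {p@(suc n)} {k} p-prime 0<k k<p with euclidsLemma (p C k) (k ! * (p ∸ k) !) p-prime p∣pCk*k!*[p∸k]!
  where
    p∣pCk*k!*[p∸k]! : p ∣ (p C k) * (k ! * (p ∸ k) !)
    p∣pCk*k!*[p∸k]! = subst (p ∣_) (sym (nCk*k!*[n∸k]!≡n! (<⇒≤ k<p))) (m∣m*n (n !))
... | inj₁ p∣pCk = p∣pCk
... | inj₂ p∣k!*[p∸k]! with euclidsLemma (k !) ((p ∸ k) !) p-prime p∣k!*[p∸k]!
...   | inj₁ p∣k!     = contradiction p∣k! (prime∤m! k p-prime k<p)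
...   | inj₂ p∣[p∸k]! = contradiction p∣[p∸k]! (prime∤m! (p ∸ k) p-prime (∸-monoʳ-< 0<k (<⇒≤ k<p)))

[1+n]Cn≡1+n : ∀ n → suc n C n ≡ suc n
[1+n]Cn≡1+n n = trans (nCk≡nC[n∸k] (n≤1+n n)) (trans (cong (suc n C_) (m+n∸n≡m 1 n)) (nC1≡n (suc n)))

-- Finite sums and the binomial theorem

×ₛ≡* : ∀ m x → m ×ₛ x ≡ m * x
×ₛ≡* zero    x = refl
×ₛ≡* (suc m) x = cong (x +_) (×ₛ≡* m x)

^ₛ≡^ : ∀ x n → x ^ₛ n ≡ x ^ n
^ₛ≡^ x zero    = refl
^ₛ≡^ x (suc n) = cong (x *_) (^ₛ≡^ x n)

∑-last : ∀ n (f : ℕ → ℕ) → ∑[ i < suc n ] f (toℕ i) ≡ ∑[ i < n ] f (toℕ i) + f n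
∑-last n f = trans (sum-init-last (f ∘ toℕ))
  (cong₂ _+_ (sum-cong-≗ {n} (λ i → cong f (toℕ-inject₁ i))) (cong f (toℕ-fromℕ n)))

∣-∑ : ∀ {d} n (f : Fin n → ℕ) → (∀ i → d ∣ f i) → d ∣ ∑[ i < n ] f i
∣-∑ zero    f d∣f = _ ∣0
∣-∑ (suc n) f d∣f = ∣m∣n⇒∣m+n (d∣f zero) (∣-∑ n (f ∘ suc) (d∣f ∘ suc))

∑-cong-mod : ∀ {m} .{{_ : NonZero m}} n (f g : Fin n → ℕ) → (∀ i → f i ≡ g i mod m) →
             ∑[ i < n ] f i ≡ ∑[ i < n ] g i mod m
∑-cong-mod zero    f g f≡g = refl
∑-cong-mod (suc n) f g f≡g = +-cong-mod (f≡g zero) (∑-cong-mod n (f ∘ suc) (g ∘ suc) (f≡g ∘ suc))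

binomial : ∀ n x → (x + 1) ^ n ≡ x ^ n + ∑[ k < n ] ((n C toℕ k) * x ^ toℕ k)
binomial n x = begin
  (x + 1) ^ n                                                 ≡⟨ ^ₛ≡^ (x + 1) n ⟨
  (x + 1) ^ₛ n                                                ≡⟨ binomialTheorem n x 1 ⟩
  ∑[ k ≤ n ] ((n C toℕ k) ×ₛ (x ^ₛ toℕ k * 1 ^ₛ (n ∸ toℕ k))) ≡⟨ sum-cong-≗ {suc n} term≡ ⟩
  ∑[ k ≤ n ] f (toℕ k)                                        ≡⟨ ∑-last n f ⟩
  ∑[ k < n ] f (toℕ k) + f n                                  ≡⟨ +-comm _ (f n) ⟩
  f n + ∑[ k < n ] f (toℕ k)                                  ≡⟨ cong (_+ (∑[ k < n ] f (toℕ k))) f[n]≡x^n ⟩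
  x ^ n + ∑[ k < n ] f (toℕ k)                                ∎
  where
    open ≡-Reasoning
    f : ℕ → ℕ
    f k = (n C k) * x ^ k
    f[n]≡x^n : f n ≡ x ^ n
    f[n]≡x^n = trans (cong (_* x ^ n) (nCn≡1 n)) (*-identityˡ (x ^ n))
    term≡ : ∀ k → (n C toℕ k) ×ₛ (x ^ₛ toℕ k * 1 ^ₛ (n ∸ toℕ k)) ≡ f (toℕ k)
    term≡ k = begin
      (n C toℕ k) ×ₛ (x ^ₛ toℕ k * 1 ^ₛ (n ∸ toℕ k)) ≡⟨ ×ₛ≡* (n C toℕ k) _ ⟩
      (n C toℕ k) * (x ^ₛ toℕ k * 1 ^ₛ (n ∸ toℕ k))  ≡⟨ cong₂ (λ y z → (n C toℕ k) * (y * z)) (^ₛ≡^ x (toℕ k)) 1^ₛ≡1 ⟩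
      (n C toℕ k) * (x ^ toℕ k * 1)                  ≡⟨ cong ((n C toℕ k) *_) (*-identityʳ (x ^ toℕ k)) ⟩
      f (toℕ k)                                      ∎
      where
        1^ₛ≡1 : 1 ^ₛ (n ∸ toℕ k) ≡ 1
        1^ₛ≡1 = trans (^ₛ≡^ 1 (n ∸ toℕ k)) (^-zeroˡ (n ∸ toℕ k))

freshman's-dream : ∀ {p} .{{_ : NonZero p}} → Prime p → ∀ x → (x + 1) ^ p ≡ x ^ p + 1 mod p
freshman's-dream {p@(suc n)} p-prime x = begin
  (x + 1) ^ p                              ≡⟨ binomial p x ⟩
  x ^ p + (1 + ∑[ k < n ] f (suc (toℕ k))) ≡⟨ +-assoc (x ^ p) 1 _ ⟨
  x ^ p + 1 + ∑[ k < n ] f (suc (toℕ k))   ≈⟨ %-remove-+ʳ (x ^ p + 1) (∣-∑ n _ p∣f) ⟩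
  x ^ p + 1                                ∎
  where
    open ≈-Reasoning (≡-mod-setoid {p})
    f : ℕ → ℕ
    f k = (p C k) * x ^ k
    p∣f : ∀ (k : Fin n) → p ∣ f (suc (toℕ k))
    p∣f k = ∣m⇒∣m*n _ (prime∣pCk p-prime z<s (s<s (toℕ<n k)))

powerSum : ℕ → ℕ → ℕ
powerSum j n = ∑[ x < n ] (toℕ x ^ j)

powerSum-suc : ∀ j n → powerSum j (suc n) ≡ powerSum j n + n ^ j
powerSum-suc j n = ∑-last n (_^ j)

-- Telescoping the binomial expansions of (x + 1)^(k+1) − x^(k+1) over x < n.
^≡∑powerSum : ∀ k n → n ^ suc k ≡ ∑[ j < suc k ] ((suc k C toℕ j) * powerSum (toℕ j) n)
^≡∑powerSum k zero =
  sym (trans (sum-cong-≗ {suc k} (λ j → *-zeroʳ (suc k C toℕ j))) (sum-replicate-zero (suc k)))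
^≡∑powerSum k (suc n) = begin
  (1 + n) ^ suc k                                                 ≡⟨ cong (_^ suc k) (+-comm 1 n) ⟩
  (n + 1) ^ suc k                                                 ≡⟨ binomial (suc k) n ⟩
  n ^ suc k + ∑[ j < suc k ] (c j * n ^ toℕ j)
    ≡⟨ cong (_+ (∑[ j < suc k ] (c j * n ^ toℕ j))) (^≡∑powerSum k n) ⟩
  ∑[ j < suc k ] (c j * S j n) + ∑[ j < suc k ] (c j * n ^ toℕ j)
    ≡⟨ ∑-distrib-+ (λ j → c j * S j n) (λ j → c j * n ^ toℕ j) ⟨
  ∑[ j < suc k ] (c j * S j n + c j * n ^ toℕ j)                   ≡⟨ sum-cong-≗ {suc k} step ⟩
  ∑[ j < suc k ] (c j * S j (suc n))                               ∎
  where
    open ≡-Reasoning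
    c : Fin (suc k) → ℕ
    c j = suc k C toℕ j
    S : Fin (suc k) → ℕ → ℕ
    S j = powerSum (toℕ j)
    step : ∀ j → c j * S j n + c j * n ^ toℕ j ≡ c j * S j (suc n)
    step j = trans (sym (*-distribˡ-+ (c j) _ _)) (cong (c j *_) (sym (powerSum-suc (toℕ j) n)))

units^r≡1⇒powerSum≡n∸1 : ∀ {n r} .{{_ : NonZero n}} → 0 < r → (∀ x → 0 < x → x < n → x ^ r ≡ 1 mod n) →
                         powerSum r n ≡ n ∸ 1 mod n
units^r≡1⇒powerSum≡n∸1 {suc n} {suc r} _ units = begin
  ∑[ x < n ] (suc (toℕ x) ^ suc r) ≈⟨ ∑-cong-mod n _ _ (λ x → units (suc (toℕ x)) z<s (s<s (toℕ<n x))) ⟩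
  ∑[ x < n ] 1                     ≡⟨ sum-replicate n ⟩
  n ×ₛ 1                           ≡⟨ trans (×ₛ≡* n 1) (*-identityʳ n) ⟩
  n                                ∎
  where open ≈-Reasoning (≡-mod-setoid {suc n})

-- Fermat's little theorem and its converse for prime moduli

module _ {p : ℕ} (p-prime : Prime p) where

  private
    0<p∸1 : 0 < p ∸ 1
    0<p∸1 = m<n⇒0<n∸m (prime>1 p-prime)
    p∸1<p : p ∸ 1 < p
    p∸1<p = ∸-monoʳ-< z<s (<⇒≤ (prime>1 p-prime))
    instance
      p≢0   = prime⇒nonZero p-prime
      p∸1≢0 = >-nonZero 0<p∸1

  prime∣*-cancelˡ : ∀ {a m} → p ∤ a → p ∣ a * m → p ∣ m
  prime∣*-cancelˡ {a} p∤a p∣a*m = [ flip contradiction p∤a , id ]′ (euclidsLemma a _ p-prime p∣a*m)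

  private
    *-cancelˡ-mod-≥ : ∀ {a b c} → p ∤ a → c ≤ b → a * b ≡ a * c mod p → b ≡ c mod p
    *-cancelˡ-mod-≥ {a} {b} {c} p∤a c≤b ab≡ac =
      ∣∸⇒≡-mod c≤b (prime∣*-cancelˡ p∤a (subst (p ∣_) (sym (*-distribˡ-∸ a b c)) (≡-mod⇒∣∸ ab≡ac)))

  *-cancelˡ-mod : ∀ {a b c} → p ∤ a → a * b ≡ a * c mod p → b ≡ c mod p
  *-cancelˡ-mod {a} {b} {c} p∤a ab≡ac with ≤-total c b
  ... | inj₁ c≤b = *-cancelˡ-mod-≥ p∤a c≤b ab≡ac
  ... | inj₂ b≤c = sym (*-cancelˡ-mod-≥ p∤a b≤c (sym ab≡ac))

  fermat-^p : ∀ a → a ^ p ≡ a mod p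
  fermat-^p zero    = cong (_% p) (subst (λ e → 0 ^ e ≡ 0) (suc-pred p) refl)
  fermat-^p (suc a) = begin
    (1 + a) ^ p ≡⟨ cong (_^ p) (+-comm 1 a) ⟩
    (a + 1) ^ p ≈⟨ freshman's-dream p-prime a ⟩
    a ^ p + 1   ≈⟨ +-cong-mod {p} (fermat-^p a) refl ⟩
    a + 1       ≡⟨ +-comm a 1 ⟩
    1 + a       ∎
    where open ≈-Reasoning (≡-mod-setoid {p})

  fermat : ∀ {a} → p ∤ a → a ^ (p ∸ 1) ≡ 1 mod p
  fermat {a} p∤a = *-cancelˡ-mod p∤a (begin
    a ^ suc (p ∸ 1) ≡⟨ cong (a ^_) (suc-pred p) ⟩
    a ^ p           ≈⟨ fermat-^p a ⟩
    a               ≡⟨ *-identityʳ a ⟨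
    a * 1           ∎)
    where open ≈-Reasoning (≡-mod-setoid {p})

  fermat-% : ∀ {x} e → p ∤ x → x ^ e ≡ x ^ (e % (p ∸ 1)) mod p
  fermat-% {x} e p∤x = begin
    x ^ e                     ≡⟨ cong (x ^_) (m≡m%n+[m/n]*n e (p ∸ 1)) ⟩
    x ^ (r + q * (p ∸ 1))     ≡⟨ ^-distribˡ-+-* x r _ ⟩
    x ^ r * x ^ (q * (p ∸ 1)) ≡⟨ cong (λ k → x ^ r * x ^ k) (*-comm q (p ∸ 1)) ⟩
    x ^ r * x ^ ((p ∸ 1) * q) ≡⟨ cong (x ^ r *_) (^-*-assoc x (p ∸ 1) q) ⟨
    x ^ r * (x ^ (p ∸ 1)) ^ q ≈⟨ *-cong-mod {p} {x ^ r} refl (^-cong-mod q (fermat p∤x)) ⟩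
    x ^ r * 1 ^ q             ≡⟨ cong (x ^ r *_) (^-zeroˡ q) ⟩
    x ^ r * 1                 ≡⟨ *-identityʳ (x ^ r) ⟩
    x ^ r                     ∎
    where
      open ≈-Reasoning (≡-mod-setoid {p})
      r = e % (p ∸ 1)
      q = e / (p ∸ 1)

  fermat-∣ : ∀ {a e} → p ∤ a → (p ∸ 1) ∣ e → a ^ e ≡ 1 mod p
  fermat-∣ {a} {e} p∤a p∸1∣e = trans (fermat-% e p∤a) (cong (λ r → a ^ r % p) (n∣m⇒m%n≡0 e (p ∸ 1) p∸1∣e))

  -- In p^(i+1) = Σ_{j ≤ i} C(i+1, j) · powerSum j p every term but the last is divisible by p
  -- by induction, and the last one is (i + 1) · powerSum i p with p ∤ i + 1.
  prime∣powerSum : ∀ i → suc i < p → p ∣ powerSum i p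
  prime∣powerSum = <-rec _ step
    where
      step : ∀ i → (∀ {j} → j < i → suc j < p → p ∣ powerSum j p) → suc i < p → p ∣ powerSum i p
      step i ih 1+i<p = prime∣*-cancelˡ (0<m<p⇒p∤m p-prime z<s 1+i<p) p∣[1+i]*powerSum
        where
          f : ℕ → ℕ
          f j = (suc i C j) * powerSum j p
          p∣lower : p ∣ ∑[ j < i ] f (toℕ j)
          p∣lower = ∣-∑ i (f ∘ toℕ) (λ j → ∣n⇒∣m*n (suc i C toℕ j) (ih (toℕ<n j) (<-trans (s<s (toℕ<n j)) 1+i<p)))
          p∣all : p ∣ ∑[ j < i ] f (toℕ j) + f i
          p∣all = subst (p ∣_) (trans (^≡∑powerSum i p) (∑-last i f)) (m∣m*n (p ^ i))
          p∣[1+i]*powerSum : p ∣ suc i * powerSum i p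
          p∣[1+i]*powerSum = subst (p ∣_) (cong (_* powerSum i p) ([1+n]Cn≡1+n i)) (∣m+n∣m⇒∣n p∣all p∣lower)

  units^e≡1⇒[p∸1]∣e : ∀ {e} → (∀ x → 0 < x → x < p → x ^ e ≡ 1 mod p) → (p ∸ 1) ∣ e
  units^e≡1⇒[p∸1]∣e {e} units with e % (p ∸ 1) in e%[p∸1]≡r
  ... | zero  = m%n≡0⇒n∣m e (p ∸ 1) e%[p∸1]≡r
  ... | suc r = ⊥-elim (0<m<p⇒p∤m p-prime 0<p∸1 p∸1<p (≡-mod⇒∣∸ p∸1≡0))
    where
      units^r≡1 : ∀ x → 0 < x → x < p → x ^ suc r ≡ 1 mod p
      units^r≡1 x 0<x x<p = begin
        x ^ suc r         ≡⟨ cong (x ^_) e%[p∸1]≡r ⟨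
        x ^ (e % (p ∸ 1)) ≈⟨ fermat-% e (0<m<p⇒p∤m p-prime 0<x x<p) ⟨
        x ^ e             ≈⟨ units x 0<x x<p ⟩
        1                 ∎
        where open ≈-Reasoning (≡-mod-setoid {p})
      2+r<p : suc (suc r) < p
      2+r<p = subst (suc (suc r) <_) (suc-pred p) (s<s (subst (_< p ∸ 1) e%[p∸1]≡r (m%n<n e (p ∸ 1))))
      p∸1≡0 : p ∸ 1 ≡ 0 mod p
      p∸1≡0 = trans (sym (units^r≡1⇒powerSum≡n∸1 {r = suc r} z<s units^r≡1))
                    (∣⇒≡0-mod (prime∣powerSum (suc r) 2+r<p))

-- Carmichael numbers

pos-^ : ∀ a e → ℤ.+ (a ^ e) ≡ (ℤ.+ a) ℤ.^ e
pos-^ a zero    = refl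
pos-^ a (suc e) = trans (ℤ.pos-* a (a ^ e)) (cong (ℤ.+ a ℤ.*_) (pos-^ a e))

∣+m-1∣≡m∸1 : ∀ {m} → 1 ≤ m → ℤ.∣ ℤ.+ m ℤ.- ℤ.+ 1 ∣ ≡ m ∸ 1
∣+m-1∣≡m∸1 {m} 1≤m = cong ℤ.∣_∣ (trans (ℤ.m-n≡m⊖n m 1) (ℤ.⊖-≥ 1≤m))

^even≡∣∣^ : ∀ b h → b ℤ.^ (h * 2) ≡ ℤ.+ (ℤ.∣ b ∣ ^ (h * 2))
^even≡∣∣^ b h = begin
  b ℤ.^ (h * 2)                ≡⟨ cong (b ℤ.^_) (*-comm h 2) ⟩
  b ℤ.^ (2 * h)                ≡⟨ ℤ.^-*-assoc b 2 h ⟨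
  (b ℤ.* (b ℤ.* ℤ.1ℤ)) ℤ.^ h   ≡⟨ cong (λ c → (b ℤ.* c) ℤ.^ h) (ℤ.*-identityʳ b) ⟩
  (b ℤ.* b) ℤ.^ h              ≡⟨ cong (ℤ._^ h) (square b) ⟩
  (ℤ.+ (ℤ.∣ b ∣ ^ 2)) ℤ.^ h     ≡⟨ pos-^ (ℤ.∣ b ∣ ^ 2) h ⟨
  ℤ.+ ((ℤ.∣ b ∣ ^ 2) ^ h)       ≡⟨ cong ℤ.+_ (trans (^-*-assoc ℤ.∣ b ∣ 2 h) (cong (ℤ.∣ b ∣ ^_) (*-comm 2 h))) ⟩
  ℤ.+ (ℤ.∣ b ∣ ^ (h * 2))       ∎
  where
    open ≡-Reasoning
    square : ∀ c → c ℤ.* c ≡ ℤ.+ (ℤ.∣ c ∣ ^ 2)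
    square (ℤ.+ n)      = trans (sym (ℤ.pos-* n n)) (cong (λ k → ℤ.+ (n * k)) (sym (*-identityʳ n)))
    square ℤ.-[1+ n ]   = cong (λ k → ℤ.+ (suc n * k)) (sym (*-identityʳ (suc n)))

carmichael⇒∣ : ∀ {N a} → IsCarmichael N → 0 < a → Coprime a N → N ∣ a ^ (N ∸ 1) ∸ 1
carmichael⇒∣ {N} {a} (_ , fermat-N) 0<a a⊥N =
  subst (N ∣_) (trans (cong (λ z → ℤ.∣ z ℤ.- ℤ.+ 1 ∣) (sym (pos-^ a (N ∸ 1))))
                      (∣+m-1∣≡m∸1 (m^n>0 a {{>-nonZero 0<a}} (N ∸ 1))))
               (fermat-N (ℤ.+ a) a⊥N)

-- An even exponent makes b^(N−1) = ∣b∣^(N−1), so negative bases reduce to natural ones.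
∣⇒carmichael : ∀ {N} → Composite N → 2 ∣ N ∸ 1 → (∀ {a} → Coprime a N → N ∣ a ^ (N ∸ 1) ∸ 1) → IsCarmichael N
∣⇒carmichael {N} N-composite (divides h N∸1≡h*2) fermat-N = N-composite , fermat-ℤ
  where
    fermat-ℤ : ∀ b → Coprime ℤ.∣ b ∣ N → N ∣ ℤ.∣ b ℤ.^ (N ∸ 1) ℤ.- ℤ.+ 1 ∣
    fermat-ℤ b b⊥N = subst (N ∣_) (sym ∣b^[N∸1]-1∣≡∣b∣^[N∸1]∸1) (fermat-N b⊥N)
      where
        0<∣b∣ : 0 < ℤ.∣ b ∣
        0<∣b∣ = n≢0⇒n>0 λ ∣b∣≡0 → <⇒≢ (nonTrivial⇒n>1 N {{composite⇒nonTrivial N-composite}})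
                                      (sym (0-coprimeTo-m⇒m≡1 (subst (λ c → Coprime c N) ∣b∣≡0 b⊥N)))
        ∣b^[N∸1]-1∣≡∣b∣^[N∸1]∸1 : ℤ.∣ b ℤ.^ (N ∸ 1) ℤ.- ℤ.+ 1 ∣ ≡ ℤ.∣ b ∣ ^ (N ∸ 1) ∸ 1
        ∣b^[N∸1]-1∣≡∣b∣^[N∸1]∸1 = begin
          ℤ.∣ b ℤ.^ (N ∸ 1) ℤ.- ℤ.+ 1 ∣           ≡⟨ cong (λ e → ℤ.∣ b ℤ.^ e ℤ.- ℤ.+ 1 ∣) N∸1≡h*2 ⟩
          ℤ.∣ b ℤ.^ (h * 2) ℤ.- ℤ.+ 1 ∣           ≡⟨ cong (λ z → ℤ.∣ z ℤ.- ℤ.+ 1 ∣) (^even≡∣∣^ b h) ⟩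
          ℤ.∣ ℤ.+ (ℤ.∣ b ∣ ^ (h * 2)) ℤ.- ℤ.+ 1 ∣ ≡⟨ ∣+m-1∣≡m∸1 (m^n>0 ℤ.∣ b ∣ {{>-nonZero 0<∣b∣}} (h * 2)) ⟩
          ℤ.∣ b ∣ ^ (h * 2) ∸ 1                  ≡⟨ cong (λ e → ℤ.∣ b ∣ ^ e ∸ 1) N∸1≡h*2 ⟨
          ℤ.∣ b ∣ ^ (N ∸ 1) ∸ 1                  ∎
          where open ≡-Reasoning

carmichael⇒≡1-mod : ∀ {N a q} .{{_ : NonZero q}} → IsCarmichael N → 0 < a → Coprime a N → q ∣ N →
                    a ^ (N ∸ 1) ≡ 1 mod q
carmichael⇒≡1-mod {N} {a} carm 0<a a⊥N q∣N =
  ∣∸⇒≡-mod (m^n>0 a {{>-nonZero 0<a}} (N ∸ 1)) (∣-trans q∣N (carmichael⇒∣ carm 0<a a⊥N))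

[1+a]^e≡1+e*a : ∀ {n a} .{{_ : NonZero n}} → n ∣ a * a → ∀ e → (1 + a) ^ e ≡ 1 + e * a mod n
[1+a]^e≡1+e*a         n∣a*a zero    = refl
[1+a]^e≡1+e*a {n} {a} n∣a*a (suc e) = begin
  (1 + a) * (1 + a) ^ e       ≈⟨ *-cong-mod {n} {1 + a} refl ([1+a]^e≡1+e*a n∣a*a e) ⟩
  (1 + a) * (1 + e * a)       ≡⟨ expand a e ⟩
  1 + suc e * a + e * (a * a) ≈⟨ %-remove-+ʳ (1 + suc e * a) (∣n⇒∣m*n e n∣a*a) ⟩
  1 + suc e * a               ∎
  where
    open ≈-Reasoning (≡-mod-setoid {n})
    expand : ∀ a e → (1 + a) * (1 + e * a) ≡ 1 + (1 + e) * a + e * (a * a)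
    expand = solve-∀

-- With a = N / p, the base 1 + a is a unit and N ∣ a², so 1 ≡ (1 + a)^(N−1) ≡ 1 + (N − 1) a (mod N):
-- then p ∣ N − 1 as well as p ∣ N.
carmichael⇒squarefree : ∀ {N p} → IsCarmichael N → Prime p → p * p ∤ N
carmichael⇒squarefree {N} {p} carm@(N-composite , _) p-prime (divides t N≡t*[p*p]) =
  0<m<p⇒p∤m p-prime z<s (prime>1 p-prime) p∣1
  where
    instance N≢0 = composite⇒nonZero N-composite
    a = t * p
    N≡a*p : N ≡ a * p
    N≡a*p = trans N≡t*[p*p] (sym (*-assoc t p p))
    instance a≢0 = m*n≢0⇒m≢0 a {{subst NonZero N≡a*p N≢0}}
    N∣a*a : N ∣ a * a
    N∣a*a = divides t (trans (regroup t p) (cong (t *_) (sym N≡t*[p*p])))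
      where
        regroup : ∀ t p → t * p * (t * p) ≡ t * (t * (p * p))
        regroup = solve-∀
    q∣N⇒q∣a : ∀ {q} → Prime q → q ∣ N → q ∣ a
    q∣N⇒q∣a {q} q-prime q∣N with euclidsLemma a p q-prime (subst (q ∣_) N≡a*p q∣N)
    ... | inj₁ q∣a = q∣a
    ... | inj₂ q∣p = subst (_∣ a) (sym (prime∣prime⇒≡ p-prime q-prime q∣p)) (n∣m*n t)
    1+a⊥N : Coprime (1 + a) N
    1+a⊥N = noCommonPrime⇒coprime λ {q} q-prime q∣1+a q∣N →
      0<m<p⇒p∤m q-prime z<s (prime>1 q-prime) (∣m+n∣m⇒∣n (subst (q ∣_) (+-comm 1 a) q∣1+a) (q∣N⇒q∣a q-prime q∣N))
    N∣[N∸1]*a : N ∣ (N ∸ 1) * a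
    N∣[N∸1]*a = subst (N ∣_) (m+n∸m≡n 1 _)
      (≡-mod⇒∣∸ (trans (sym ([1+a]^e≡1+e*a N∣a*a (N ∸ 1))) (carmichael⇒≡1-mod carm z<s 1+a⊥N ∣-refl)))
    p∣N∸1 : p ∣ N ∸ 1
    p∣N∸1 = *-cancelˡ-∣ a (subst₂ _∣_ N≡a*p (*-comm (N ∸ 1) a) N∣[N∸1]*a)
    p∣1 : p ∣ 1
    p∣1 = ∣m+n∣m⇒∣n (subst (p ∣_) (sym (m∸n+n≡m (>-nonZero⁻¹ N))) (divides a N≡a*p)) p∣N∸1

-- For 0 < x < p the base b = 1 + (x − 1)·m^(p−1), m = N / p, is ≡ x modulo p (Fermat, as p ∤ m)
-- and ≡ 1 modulo every prime factor of m, so it is a unit and x^(N−1) ≡ b^(N−1) ≡ 1 (mod p).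
carmichael⇒korselt : ∀ {N p} → IsCarmichael N → Prime p → p ∣ N → (p ∸ 1) ∣ (N ∸ 1)
carmichael⇒korselt {N} {p} carm p-prime p∣N@(divides m N≡m*p) = units^e≡1⇒[p∸1]∣e p-prime units^[N∸1]≡1
  where
    instance
      p≢0   = prime⇒nonZero p-prime
      p∸1≢0 = >-nonZero (m<n⇒0<n∸m (prime>1 p-prime))
    p∤m : p ∤ m
    p∤m p∣m = carmichael⇒squarefree carm p-prime (subst (p * p ∣_) (sym N≡m*p) (*-monoˡ-∣ p p∣m))
    units^[N∸1]≡1 : ∀ x → 0 < x → x < p → x ^ (N ∸ 1) ≡ 1 mod p
    units^[N∸1]≡1 x 0<x x<p = begin
      x ^ (N ∸ 1) ≈⟨ ^-cong-mod (N ∸ 1) b≡x ⟨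
      b ^ (N ∸ 1) ≈⟨ carmichael⇒≡1-mod carm z<s b⊥N p∣N ⟩
      1           ∎
      where
        open ≈-Reasoning (≡-mod-setoid {p})
        b = 1 + (x ∸ 1) * m ^ (p ∸ 1)
        b≡x : b ≡ x mod p
        b≡x = begin
          1 + (x ∸ 1) * m ^ (p ∸ 1) ≈⟨ +-cong-mod {p} {1} refl (*-cong-mod {p} {x ∸ 1} refl (fermat p-prime p∤m)) ⟩
          1 + (x ∸ 1) * 1           ≡⟨ cong suc (*-identityʳ (x ∸ 1)) ⟩
          1 + (x ∸ 1)               ≡⟨ m+[n∸m]≡n 0<x ⟩
          x                         ∎
        q∤b : ∀ {q} → Prime q → q ∣ m * p → q ∤ b
        q∤b {q} q-prime q∣m*p q∣b with euclidsLemma m p q-prime q∣m*p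
        ... | inj₁ q∣m = 0<m<p⇒p∤m q-prime z<s (prime>1 q-prime)
                           (∣m+n∣m⇒∣n (subst (q ∣_) (+-comm 1 _) q∣b) (∣n⇒∣m*n (x ∸ 1) q∣m^[p∸1]))
          where
            q∣m^[p∸1] : q ∣ m ^ (p ∸ 1)
            q∣m^[p∸1] = subst (λ e → q ∣ m ^ e) (suc-pred (p ∸ 1)) (∣m⇒∣m*n _ q∣m)
        ... | inj₂ q∣p = 0<m<p⇒p∤m p-prime 0<x x<p (≡-mod⇒∣∸ (trans (sym b≡x) (∣⇒≡0-mod p∣b)))
          where
            p∣b : p ∣ b
            p∣b = subst (_∣ b) (prime∣prime⇒≡ p-prime q-prime q∣p) q∣b
        b⊥N : Coprime b N
        b⊥N = noCommonPrime⇒coprime λ q-prime q∣b q∣N → q∤b q-prime (subst (_ ∣_) N≡m*p q∣N) q∣b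

korselt⇒fermat : ∀ {qs a} → All Prime qs → AllPairs _≢_ qs → All (λ q → (q ∸ 1) ∣ (product qs ∸ 1)) qs →
                 Coprime a (product qs) → product qs ∣ a ^ (product qs ∸ 1) ∸ 1
korselt⇒fermat {qs} {a} qs-prime qs-distinct korselt a⊥N =
  distinctPrimes-∣⇒product∣ qs-prime qs-distinct (All.tabulate q∣a^[N∸1]∸1)
  where
    q∣a^[N∸1]∸1 : ∀ {q} → q ∈ qs → q ∣ a ^ (product qs ∸ 1) ∸ 1
    q∣a^[N∸1]∸1 {q} q∈qs = ≡-mod⇒∣∸ (fermat-∣ q-prime q∤a (All.lookup korselt q∈qs))
      where
        q-prime = All.lookup qs-prime q∈qs
        instance _ = prime⇒nonZero q-prime
        q∤a : q ∤ a
        q∤a q∣a = contradiction (subst Prime (a⊥N (q∣a , ∈⇒∣product q∈qs)) q-prime) ¬prime[1]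

m*n∸1≡[m∸1]*n+[n∸1] : ∀ m n → 0 < m → 0 < n → m * n ∸ 1 ≡ (m ∸ 1) * n + (n ∸ 1)
m*n∸1≡[m∸1]*n+[n∸1] (suc m) (suc n) _ _ = +-comm n (m * suc n)

carmichael⇒cofactor : ∀ {N p} → IsCarmichael N → Prime p → p ∣ N → ∃[ k ] N ≡ p * (1 + k * (p ∸ 1))
carmichael⇒cofactor {N} {p} carm@(N-composite , _) p-prime p∣N@(divides m N≡m*p) =
  quotient p∸1∣m∸1 , trans N≡p*m (cong (p *_) (trans (sym (suc-pred m)) (cong suc (m∣n⇒n≡quotient*m p∸1∣m∸1))))
  where
    N≡p*m : N ≡ p * m
    N≡p*m = trans N≡m*p (*-comm m p)
    instance m≢0 = m*n≢0⇒n≢0 p {{subst NonZero N≡p*m (composite⇒nonZero N-composite)}}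
    N∸1≡[p∸1]*m+[m∸1] : N ∸ 1 ≡ (p ∸ 1) * m + (m ∸ 1)
    N∸1≡[p∸1]*m+[m∸1] = trans (cong (_∸ 1) N≡p*m)
                              (m*n∸1≡[m∸1]*n+[n∸1] p m (<-trans z<s (prime>1 p-prime)) (>-nonZero⁻¹ m))
    p∸1∣m∸1 : (p ∸ 1) ∣ (m ∸ 1)
    p∸1∣m∸1 = ∣m+n∣m⇒∣n (subst ((p ∸ 1) ∣_) N∸1≡[p∸1]*m+[m∸1] (carmichael⇒korselt carm p-prime p∣N))
                        (m∣m*n m)

cofactor-mono-≤ : ∀ {p₀ p k₀ k} → p₀ ≤ p → k₀ ≤ k → p₀ * (1 + k₀ * (p₀ ∸ 1)) ≤ p * (1 + k * (p ∸ 1))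
cofactor-mono-≤ p₀≤p k₀≤k = *-mono-≤ p₀≤p (s≤s (*-mono-≤ k₀≤k (∸-monoˡ-≤ 1 p₀≤p)))

-- Certificates checked by evaluation

-- The search below runs inside the type checker, where these direct Boolean versions evaluate about
-- twice as fast as does (d ∣? n) and Data.Bool.ListAction.any.
_∣ᵇ_ : ℕ → ℕ → Bool
zero  ∣ᵇ n = n ≡ᵇ 0
suc d ∣ᵇ n = n % suc d ≡ᵇ 0

anyᵇ : (ℕ → Bool) → List ℕ → Bool
anyᵇ f []       = false
anyᵇ f (x ∷ xs) = f x ∨ anyᵇ f xs

∣ᵇ⇒∣ : ∀ d n → T (d ∣ᵇ n) → d ∣ n
∣ᵇ⇒∣ zero    n t = subst (0 ∣_) (sym (≡ᵇ⇒≡ n 0 t)) (0 ∣0)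
∣ᵇ⇒∣ (suc d) n t = m%n≡0⇒n∣m n (suc d) (≡ᵇ⇒≡ _ 0 t)

∣⇒∣ᵇ : ∀ d n → d ∣ n → T (d ∣ᵇ n)
∣⇒∣ᵇ zero    n 0∣n = ≡⇒≡ᵇ n 0 (0∣⇒≡0 0∣n)
∣⇒∣ᵇ (suc d) n d∣n = ≡⇒≡ᵇ _ 0 (n∣m⇒m%n≡0 n (suc d) d∣n)

T-not⇒¬T : ∀ {b} → T (not b) → ¬ T b
T-not⇒¬T {false} _ ()

¬∣ᵇ⇒∤ : ∀ d n → T (not (d ∣ᵇ n)) → d ∤ n
¬∣ᵇ⇒∤ d n t = T-not⇒¬T t ∘ ∣⇒∣ᵇ d n

anyᵇ⇒∃ : ∀ f xs → T (anyᵇ f xs) → ∃[ x ] x ∈ xs × T (f x)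
anyᵇ⇒∃ f (x ∷ xs) t with to T-∨ t
... | inj₁ fx   = x , here refl , fx
... | inj₂ rest with anyᵇ⇒∃ f xs rest
...   | y , y∈xs , fy = y , there y∈xs , fy

allFromᵇ : (ℕ → Bool) → ℕ → ℕ → Bool
allFromᵇ f a zero    = true
allFromᵇ f a (suc n) = f a ∧ allFromᵇ f (suc a) n

allFromᵇ⇒ : ∀ f a n → allFromᵇ f a n ≡ true → ∀ {x} → a ≤ x → x < a + n → T (f x)
allFromᵇ⇒ f a zero    _  {x} a≤x x<a+0 = contradiction (subst (x <_) (+-identityʳ a) x<a+0) (≤⇒≯ a≤x)
allFromᵇ⇒ f a (suc n) eq {x} a≤x x<a+n with to T-∧ (subst T (sym eq) _) | m≤n⇒m<n∨m≡n a≤x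
... | fa , _    | inj₂ refl = fa
... | _  , rest | inj₁ a<x  = allFromᵇ⇒ f (suc a) n (to T-≡ rest) a<x (subst (x <_) (+-suc a n) x<a+n)

noDivisorBelow : ℕ → ℕ → Bool
noDivisorBelow n zero    = true
noDivisorBelow n (suc k) = noDivisorBelow n k ∧ not ((2 + k) ∣ᵇ n)

noDivisorBelow⇒rough : ∀ n k → T (noDivisorBelow n k) → (2 + k) Rough n
noDivisorBelow⇒rough n zero    _ = 2-rough
noDivisorBelow⇒rough n (suc k) t =
  ∤⇒rough-suc (¬∣ᵇ⇒∤ (2 + k) n (proj₂ (to T-∧ t))) (noDivisorBelow⇒rough n k (proj₁ (to T-∧ t)))

prime-byTrialDivision : ∀ n k → 1 < n → n < (2 + k) * (2 + k) → T (noDivisorBelow n k) → Prime n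
prime-byTrialDivision n k 1<n n<[2+k]² t =
  rough∧square>⇒prime {{n>1⇒nonTrivial 1<n}} (noDivisorBelow⇒rough n k t) n<[2+k]²

-- The fuel only bounds the number of halvings of the exponent: once it runs out the power is
-- computed directly, so the result is correct for any fuel (64 suffices for exponents below 2⁶⁴).
powMod : ℕ → ℕ → ℕ → (m : ℕ) → .{{NonZero m}} → ℕ
powMod zero    b e m = b ^ e % m
powMod (suc f) b e m = b ^ (e % 2) * powMod f (b * b % m) (e / 2) m % m

powMod-correct : ∀ f b e m .{{_ : NonZero m}} → powMod f b e m ≡ b ^ e % m
powMod-correct zero    b e m = refl
powMod-correct (suc f) b e m = begin
  b ^ r * powMod f (b * b % m) h m ≡⟨ cong (b ^ r *_) (powMod-correct f (b * b % m) h m) ⟩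
  b ^ r * ((b * b % m) ^ h % m)     ≈⟨ *-cong-mod {m} {b ^ r} refl (m%n%n≡m%n ((b * b % m) ^ h) m) ⟩
  b ^ r * (b * b % m) ^ h           ≈⟨ *-cong-mod {m} {b ^ r} refl (^-cong-mod h (m%n%n≡m%n (b * b) m)) ⟩
  b ^ r * (b * b) ^ h               ≡⟨ cong (λ c → b ^ r * (b * c) ^ h) (*-identityʳ b) ⟨
  b ^ r * (b ^ 2) ^ h               ≡⟨ cong (b ^ r *_) (^-*-assoc b 2 h) ⟩
  b ^ r * b ^ (2 * h)               ≡⟨ ^-distribˡ-+-* b r (2 * h) ⟨
  b ^ (r + 2 * h)                   ≡⟨ cong (λ k → b ^ (r + k)) (*-comm 2 h) ⟩
  b ^ (r + h * 2)                   ≡⟨ cong (b ^_) (m≡m%n+[m/n]*n e 2) ⟨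
  b ^ e                             ∎
  where
    open ≈-Reasoning (≡-mod-setoid {m})
    r = e % 2
    h = e / 2

smallPrimes : List ℕ
smallPrimes = 2 ∷ 3 ∷ 5 ∷ 7 ∷ 11 ∷ 13 ∷ 17 ∷ 19 ∷ 23 ∷ 29 ∷ 31 ∷ 37 ∷ 41
            ∷ 43 ∷ 47 ∷ 53 ∷ 59 ∷ 61 ∷ 67 ∷ 71 ∷ 73 ∷ 79 ∷ 83 ∷ 89 ∷ 97 ∷ []

viaSmallPrime : ∀ {f} {A : Set} → (∀ {q} → Prime q → q < 100 → T (f q) → A) → T (anyᵇ f smallPrimes) → A
viaSmallPrime k t with anyᵇ⇒∃ _ smallPrimes t
... | q , q∈ , fq = k (All.lookup (from-yes (all? prime? smallPrimes)) q∈)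
                       (All.lookup (from-yes (all? (_<? 100) smallPrimes)) q∈) fq

korseltWitness : ℕ → ℕ → Bool
korseltWitness N q = q ∣ᵇ N ∧ not ((q ∸ 1) ∣ᵇ (N ∸ 1))

fermatWitness : ℕ → ℕ → Bool
fermatWitness zero      b = false
fermatWitness N@(suc _) b = not (b ∣ᵇ N) ∧ not (powMod 64 b (N ∸ 1) N ≡ᵇ 1)

korseltWitness⇒¬carmichael : ∀ {N q} → Prime q → T (korseltWitness N q) → ¬ IsCarmichael N
korseltWitness⇒¬carmichael {N} {q} q-prime t carm =
  ¬∣ᵇ⇒∤ (q ∸ 1) (N ∸ 1) (proj₂ (to T-∧ t)) (carmichael⇒korselt carm q-prime (∣ᵇ⇒∣ q N (proj₁ (to T-∧ t))))

fermatWitness⇒¬carmichael : ∀ {N b} → Prime b → T (fermatWitness N b) → ¬ IsCarmichael N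
fermatWitness⇒¬carmichael {N@(suc _)} {b} b-prime t carm@(N-composite , _) =
  T-not⇒¬T (proj₂ (to T-∧ t)) (≡⇒≡ᵇ _ 1 powMod≡1)
  where
    b⊥N = prime∤⇒coprime b-prime (¬∣ᵇ⇒∤ b N (proj₁ (to T-∧ t)))
    powMod≡1 : powMod 64 b (N ∸ 1) N ≡ 1
    powMod≡1 = begin
      powMod 64 b (N ∸ 1) N ≡⟨ powMod-correct 64 b (N ∸ 1) N ⟩
      b ^ (N ∸ 1) % N       ≡⟨ carmichael⇒≡1-mod carm (<-trans z<s (prime>1 b-prime)) b⊥N ∣-refl ⟩
      1 % N                 ≡⟨ m<n⇒m%n≡m (nonTrivial⇒n>1 N {{composite⇒nonTrivial N-composite}}) ⟩
      1                     ∎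
      where open ≡-Reasoning

refutes : ℕ → Bool
refutes p = anyᵇ (_∣ᵇ p) smallPrimes ∨ anyᵇ (korseltWitness N) smallPrimes ∨ anyᵇ (fermatWitness N) smallPrimes
  where N = p * (1 + 2 * (p ∸ 1))

refutes⇒ : ∀ {p} → 100 ≤ p → T (refutes p) → Prime p → ¬ IsCarmichael (p * (1 + 2 * (p ∸ 1)))
refutes⇒ {p} 100≤p t p-prime with to T-∨ t
... | inj₁ smallFactor = ⊥-elim (viaSmallPrime (λ q-prime q<100 q∣ᵇp →
        <⇒≢ (<-≤-trans q<100 100≤p) (prime∣prime⇒≡ p-prime q-prime (∣ᵇ⇒∣ _ p q∣ᵇp))) smallFactor)
... | inj₂ t′ with to T-∨ t′
...   | inj₁ korselt = viaSmallPrime (λ q-prime _ → korseltWitness⇒¬carmichael q-prime) korselt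
...   | inj₂ fermat  = viaSmallPrime (λ b-prime _ → fermatWitness⇒¬carmichael b-prime) fermat

-- Evaluating this equation is the search over 704988734 ≤ p ≤ 707106781; it takes a couple of minutes.
refutes-range : allFromᵇ refutes 704988734 2118048 ≡ true
refutes-range = refl

¬carmichael-p[2p-1] : ∀ {p} → 704988733 < p → p * (1 + 2 * (p ∸ 1)) ≤ 10 ^ 18 → Prime p →
                      ¬ IsCarmichael (p * (1 + 2 * (p ∸ 1)))
¬carmichael-p[2p-1] {p} p>lo N≤10¹⁸ p-prime with p ≤? 707106781
... | yes p≤hi = refutes⇒ (≤-trans (from-yes (100 ≤? 704988734)) p>lo)
                   (allFromᵇ⇒ refutes 704988734 2118048 refutes-range p>lo (s≤s p≤hi)) p-prime
... | no p≰hi  = contradiction (≤-trans (cofactor-mono-≤ {k₀ = 2} (≰⇒> p≰hi) ≤-refl) N≤10¹⁸)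
                   (<⇒≱ (from-yes (10 ^ 18 <? 707106782 * (1 + 2 * 707106781))))

carmichael-primeFactor≤ : ∀ N p → N ≤ 10 ^ 18 → IsCarmichael N → Prime p → p ∣ N → p ≤ 704988733
carmichael-primeFactor≤ N p N≤10¹⁸ carm p-prime p∣N =
  decidable-stable (p ≤? 704988733) λ p≰ → excluded (≰⇒> p≰) k N≡p*[1+k*[p∸1]] carm
  where
    k = proj₁ (carmichael⇒cofactor carm p-prime p∣N)
    N≡p*[1+k*[p∸1]] = proj₂ (carmichael⇒cofactor carm p-prime p∣N)
    excluded : 704988733 < p → ∀ k → N ≡ p * (1 + k * (p ∸ 1)) → ¬ IsCarmichael N
    excluded _    0 N≡p*1 (N-composite , _) =
      composite⇒¬prime (subst Composite (trans N≡p*1 (*-identityʳ p)) N-composite) p-prime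
    excluded p>lo 1 N≡p*p carm =
      carmichael⇒squarefree carm p-prime (divides 1 (trans N≡p*p (trans (cong (p *_) 1+[p∸1]≡p) (sym (*-identityˡ (p * p))))))
      where
        1+[p∸1]≡p : 1 + 1 * (p ∸ 1) ≡ p
        1+[p∸1]≡p = trans (cong suc (*-identityˡ (p ∸ 1))) (suc-pred p {{>-nonZero (<-trans z<s p>lo)}})
    excluded p>lo 2 N≡ =
      subst (¬_ ∘ IsCarmichael) (sym N≡) (¬carmichael-p[2p-1] p>lo (subst (_≤ 10 ^ 18) N≡ N≤10¹⁸) p-prime)
    excluded p>lo (suc (suc (suc k))) N≡ _ =
      <⇒≱ (from-yes (10 ^ 18 <? 704988734 * (1 + 3 * 704988733)))
          (≤-trans (cofactor-mono-≤ {k₀ = 3} {k = 3 + k} p>lo (m≤m+n 3 k)) (subst (_≤ 10 ^ 18) N≡ N≤10¹⁸))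

prime-704988733 : Prime 704988733
prime-704988733 = prime-byTrialDivision 704988733 26550 (from-yes (1 <? 704988733)) (from-yes (704988733 <? 26552 * 26552)) _

carmichael-994018226608901845 : IsCarmichael 994018226608901845
carmichael-994018226608901845 =
  ∣⇒carmichael (composite {5} (from-yes (5 <? N)) (from-yes (5 ∣? N))) (from-yes (2 ∣? N ∸ 1))
    (korselt⇒fermat factors-prime (from-yes (allPairs? (λ m n → ¬? (m ≟ n)) factors))
                                  (from-yes (all? (λ q → (q ∸ 1) ∣? (N ∸ 1)) factors)))
  where
    N = 994018226608901845
    factors : List ℕ
    factors = 704988733 ∷ 5 ∷ 13 ∷ 1733 ∷ 12517 ∷ []
    factors-prime : All Prime factors
    factors-prime = prime-704988733 ∷ from-yes (all? prime? (5 ∷ 13 ∷ 1733 ∷ 12517 ∷ []))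

mainTheorem3 :
    (Prime 704988733 × 994018226608901845 ≤ 10 ^ 18 × IsCarmichael 994018226608901845
      × 704988733 ∣ 994018226608901845
      × 994018226608901845 ≡ 5 * 13 * 1733 * 12517 * 704988733)
    × (∀ (N p : ℕ) → N ≤ 10 ^ 18 → IsCarmichael N → Prime p → p ∣ N → p ≤ 704988733)
mainTheorem3 =
  ( prime-704988733
  , from-yes (994018226608901845 ≤? 10 ^ 18)
  , carmichael-994018226608901845
  , from-yes (704988733 ∣? 994018226608901845)
  , refl )
  , carmichael-primeFactor≤
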